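{- For any countable regular theories $T_1$ and $T_2$, the Boolean algebras $\mathcal{B}_\omega(T_1)$ and $\mathcal{B}_\omega(T_2)$ are isomorphic.
   Context: A structure is regular if it is relational and no two distinct signature symbols have the same interpretation; a regular theory is the theory of a regular structure. For a regular structure $\mathcal{M}$ with universe $M$, $\overline{\mathcal{M}}$ is a maximal regular expansion of $\mathcal{M}$ on the same universe (every relation of every finite arity on $M$ named by exactly one symbol), $B(\mathcal{M})$ is the set of restrictions of $\overline{\mathcal{M}}$ to subsignatures (universe $M$), with the Boolean algebra structure induced by union and intersection of signatures. Replacing each $\mathcal{M}'\in B(\mathcal{M})$ by ${\rm Th}(\mathcal{M}')$ gives an isomorphic Boolean algebra, ordered by $T'\le T''$ iff $T''$ expands $T'$, denoted $\mathcal{B}_\lambda(T)$ with $T={\rm Th}(\mathcal{M})$ and $\lambda=|M|$. -}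

module Defs where

open import Data.Nat using (ℕ; suc)
open import Data.Bool using (Bool; true; false; _∧_; _∨_; not)
open import Data.Vec using (Vec)
open import Data.Product using (Σ; _×_; _,_; proj₁; proj₂)
open import Relation.Binary.PropositionalEquality using (_≡_; refl)
open import Function.Definitions using (Injective)
open import Function.Bundles using (_↔_)
open import Level using (0ℓ)
open import Algebra.Lattice.Bundles using (RawLattice)
open import Algebra.Lattice.Morphism.Structures using (module LatticeMorphisms)

record Structure : Set₁ where
  field
    Carrier : Set
    Sym     : Set
    arity   : Sym → ℕ                      -- symbol s has arity suc (arity s)
    interp  : (s : Sym) → Vec Carrier (suc (arity s)) → Bool

-- A finitary relation on M (of arity suc n): an element of the
-- signature of the maximal regular expansion.
FinRel : Set → Set
FinRel M = Σ ℕ λ n → Vec M (suc n) → Bool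

_≈ᴿ_ : {M : Set} → FinRel M → FinRel M → Set
_≈ᴿ_ {M} (n , r) (m , s) = Σ (n ≡ m) λ { refl → ∀ (v : Vec M (suc n)) → r v ≡ s v }

⟦_⟧ˢ : (𝓜 : Structure) → Structure.Sym 𝓜 → FinRel (Structure.Carrier 𝓜)
⟦ 𝓜 ⟧ˢ s = Structure.arity 𝓜 s , Structure.interp 𝓜 s

Regular : Structure → Set
Regular 𝓜 = ∀ (s t : Structure.Sym 𝓜) → ⟦ 𝓜 ⟧ˢ s ≈ᴿ ⟦ 𝓜 ⟧ˢ t → s ≡ t

-- Countable theory: countable signature (injection into ℕ).
CountableSignature : Structure → Set
CountableSignature 𝓜 = Σ (Structure.Sym 𝓜 → ℕ) λ f → Injective _≡_ _≡_ f

UniverseOfSizeω : Structure → Set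
UniverseOfSizeω 𝓜 = Structure.Carrier 𝓜 ↔ ℕ

-- The maximal regular expansion of 𝓜 names every finitary relation on
-- the universe by exactly one symbol; we take its symbols to be the
-- relations themselves (up to ≈ᴿ).  An element of B(𝓜) is the
-- restriction of this expansion to a subsignature, i.e. a subset of
-- the set of symbols, given by a characteristic function respecting ≈ᴿ.
SubSig : Set → Set
SubSig M = Σ (FinRel M → Bool) λ P → ∀ {r s} → r ≈ᴿ s → P r ≡ P s

module _ {M : Set} where

  _≈ˢ_ : SubSig M → SubSig M → Set
  A ≈ˢ B = ∀ r → proj₁ A r ≡ proj₁ B r

  _∪ˢ_ : SubSig M → SubSig M → SubSig M
  (P , p) ∪ˢ (Q , q) = (λ r → P r ∨ Q r) , λ e → cong₂' (p e) (q e)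
    where
    cong₂' : ∀ {a b c d : Bool} → a ≡ b → c ≡ d → (a ∨ c) ≡ (b ∨ d)
    cong₂' refl refl = refl

  _∩ˢ_ : SubSig M → SubSig M → SubSig M
  (P , p) ∩ˢ (Q , q) = (λ r → P r ∧ Q r) , λ e → cong₂' (p e) (q e)
    where
    cong₂' : ∀ {a b c d : Bool} → a ≡ b → c ≡ d → (a ∧ c) ≡ (b ∧ d)
    cong₂' refl refl = refl

  ∁ˢ : SubSig M → SubSig M
  ∁ˢ (P , p) = (λ r → not (P r)) , λ e → cong' (p e)
    where
    cong' : ∀ {a b : Bool} → a ≡ b → not a ≡ not b
    cong' refl = refl

  ∅ˢ : SubSig M
  ∅ˢ = (λ _ → false) , λ _ → refl

  fullˢ : SubSig M
  fullˢ = (λ _ → true) , λ _ → refl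

𝔹-lattice : Structure → RawLattice 0ℓ 0ℓ
𝔹-lattice 𝓜 = record
  { Carrier = SubSig (Structure.Carrier 𝓜)
  ; _≈_     = _≈ˢ_
  ; _∧_     = _∩ˢ_
  ; _∨_     = _∪ˢ_
  }

record IsBAIsomorphism (𝓜₁ 𝓜₂ : Structure)
         (f : SubSig (Structure.Carrier 𝓜₁) → SubSig (Structure.Carrier 𝓜₂)) : Set where
  open LatticeMorphisms (𝔹-lattice 𝓜₁) (𝔹-lattice 𝓜₂)
  field
    isLatticeIsomorphism : IsLatticeIsomorphism f
    ∁-homo  : ∀ A → f (∁ˢ A) ≈ˢ ∁ˢ (f A)
    ∅-homo  : f ∅ˢ ≈ˢ ∅ˢ
    full-homo : f fullˢ ≈ˢ fullˢ

BIsomorphic : Structure → Structure → Set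
BIsomorphic 𝓜₁ 𝓜₂ =
  Σ (SubSig (Structure.Carrier 𝓜₁) → SubSig (Structure.Carrier 𝓜₂))
    (IsBAIsomorphism 𝓜₁ 𝓜₂)

{-# OPTIONS --safe #-}
module Submission where

-- B(𝓜) depends only on the universe M: it is the algebra of all ≈ᴿ-closed
-- sets of finitary relations on M, with the Boolean operations computed
-- pointwise.  A bijection M₁ ↔ M₂ transports relations by pulling back
-- along it, and taking preimages under this transport is a Boolean algebra
-- isomorphism.  Any two universes of size ω are in bijection.

open import Defs
open import Data.Vec using (map)
open import Data.Vec.Properties using (map-∘; map-cong; map-id)
open import Data.Product using (_,_)
open import Function using (_∘_; id)
open import Function.Bundles using (_↔_; Inverse)
open import Function.Properties.Inverse using (↔-sym; ↔-trans)
open import Relation.Binary.PropositionalEquality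
  using (_≡_; refl; sym; trans; cong; module ≡-Reasoning)

pullback : {A B : Set} → (A → B) → FinRel B → FinRel A
pullback f (n , r) = n , r ∘ map f

pullback-resp-≈ᴿ : {A B : Set} (f : A → B) {r s : FinRel B} →
                   r ≈ᴿ s → pullback f r ≈ᴿ pullback f s
pullback-resp-≈ᴿ f {n , r} {.n , s} (refl , r≗s) = refl , r≗s ∘ map f

pullback-inverse : {A B : Set} {f : A → B} {g : B → A} →
                   (∀ x → g (f x) ≡ x) → ∀ r → pullback f (pullback g r) ≈ᴿ r
pullback-inverse {f = f} {g} g∘f≗id (n , r) = refl , λ v → cong r (map-inverse v)
  where
  open ≡-Reasoning
  map-inverse : ∀ {m} v → map {n = m} g (map f v) ≡ v
  map-inverse v = begin
    map g (map f v)  ≡⟨ sym (map-∘ g f v) ⟩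
    map (g ∘ f) v    ≡⟨ map-cong g∘f≗id v ⟩
    map id v         ≡⟨ map-id v ⟩
    v                ∎

sigMap : {M₁ M₂ : Set} → (M₁ → M₂) → SubSig M₁ → SubSig M₂
sigMap f (P , P-resp) = P ∘ pullback f , P-resp ∘ pullback-resp-≈ᴿ f

module _ {M₁ M₂ : Set} {f : M₁ → M₂} {g : M₂ → M₁} where

  sigMap-injective : (∀ x → g (f x) ≡ x) →
                     ∀ A B → sigMap f A ≈ˢ sigMap f B → A ≈ˢ B
  sigMap-injective g∘f≗id (P , P-resp) (Q , Q-resp) fA≈fB r = begin
    P r                            ≡⟨ sym (P-resp (pullback-inverse g∘f≗id r)) ⟩
    P (pullback f (pullback g r))  ≡⟨ fA≈fB (pullback g r) ⟩
    Q (pullback f (pullback g r))  ≡⟨ Q-resp (pullback-inverse g∘f≗id r) ⟩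
    Q r                            ∎
    where open ≡-Reasoning

  sigMap-inverse : (∀ y → f (g y) ≡ y) →
                   ∀ A B → A ≈ˢ sigMap g B → sigMap f A ≈ˢ B
  sigMap-inverse f∘g≗id (P , _) (Q , Q-resp) A≈gB r =
    trans (A≈gB (pullback f r)) (Q-resp (pullback-inverse f∘g≗id r))

sigMap-isBAIsomorphism : (𝓜₁ 𝓜₂ : Structure)
                         (e : Structure.Carrier 𝓜₁ ↔ Structure.Carrier 𝓜₂) →
                         IsBAIsomorphism 𝓜₁ 𝓜₂ (sigMap (Inverse.to e))
sigMap-isBAIsomorphism 𝓜₁ 𝓜₂ e = record
  { isLatticeIsomorphism = record
    { isLatticeMonomorphism = record
      { isLatticeHomomorphism = record
        { isRelHomomorphism = record { cong = λ A≈B → A≈B ∘ pullback to }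
        ; ∧-homo = λ _ _ _ → refl
        ; ∨-homo = λ _ _ _ → refl
        }
      ; injective = λ {A} {B} → sigMap-injective {g = from} strictlyInverseʳ A B
      }
    ; surjective = λ B → sigMap from B , λ {A} → sigMap-inverse strictlyInverseˡ A B
    }
  ; ∁-homo    = λ _ _ → refl
  ; ∅-homo    = λ _ → refl
  ; full-homo = λ _ → refl
  }
  where open Inverse e

↔⇒BIsomorphic : (𝓜₁ 𝓜₂ : Structure) →
                Structure.Carrier 𝓜₁ ↔ Structure.Carrier 𝓜₂ → BIsomorphic 𝓜₁ 𝓜₂
↔⇒BIsomorphic 𝓜₁ 𝓜₂ e = sigMap (Inverse.to e) , sigMap-isBAIsomorphism 𝓜₁ 𝓜₂ e

corollary2p5 : (𝓜₁ 𝓜₂ : Structure)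
    → Regular 𝓜₁ → CountableSignature 𝓜₁ → UniverseOfSizeω 𝓜₁
    → Regular 𝓜₂ → CountableSignature 𝓜₂ → UniverseOfSizeω 𝓜₂
    → BIsomorphic 𝓜₁ 𝓜₂
corollary2p5 𝓜₁ 𝓜₂ _ _ M₁↔ℕ _ _ M₂↔ℕ = ↔⇒BIsomorphic 𝓜₁ 𝓜₂ (↔-trans M₁↔ℕ (↔-sym M₂↔ℕ))
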